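{- The Set-Fmla logic $\mathcal{PP}^{\Rightarrow_H}_{\le}$ is not determined by any single logical matrix. The same holds for the Set-Set logics $\mathcal{PP}^{\rhd,\Rightarrow_H}_{\le}$ and $\mathcal{PP}^{\rhd,\Rightarrow_H}_{\mathsf{up}}$.
   Context: Let $\mathcal{V}_6=\{\hat{\mathbf f},\mathbf f,\mathbf n,\mathbf b,\mathbf t,\hat{\mathbf t}\}$, partially ordered as a bounded distributive lattice by $\hat{\mathbf f}<\mathbf f<\mathbf n<\mathbf t<\hat{\mathbf t}$ and $\mathbf f<\mathbf b<\mathbf t$, with $\mathbf n,\mathbf b$ incomparable. $\mathbf{PP}_6$ is the algebra on $\mathcal V_6$ in the signature $\{\land,\lor,{\sim},\circ,\bot,\top\}$ where $\land,\lor$ are meet and join, $\bot=\hat{\mathbf f}$, $\top=\hat{\mathbf t}$, ${\sim}$ swaps $\mathbf f\leftrightarrow\mathbf t$ and $\hat{\mathbf f}\leftrightarrow\hat{\mathbf t}$ and fixes $\mathbf n,\mathbf b$, and ${\circ}a=\hat{\mathbf t}$ if $a\in\{\hat{\mathbf f},\hat{\mathbf t}\}$, ${\circ}a=\hat{\mathbf f}$ otherwise. $\mathbf{PP}_6^{\Rightarrow_H}$ expands $\mathbf{PP}_6$ by $a\Rightarrow b=\max\{c: a\land c\le b\}$. ${\uparrow}a=\{c: a\le c\}$. Logic of matrices: a (logical) matrix is $\langle\mathbf A,D\rangle$ with $\mathbf A$ an algebra of the signature and $D\subseteq A$; the Set-Set logic determined by a class $\mathcal M$ of matrices is: $\Phi\rhd\Psi$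 iff for every $\langle\mathbf A,D\rangle\in\mathcal M$ and homomorphism $h$ from formulas to $\mathbf A$, $h(\varphi)\notin D$ for some $\varphi\in\Phi$ or $h(\psi)\in D$ for some $\psi\in\Psi$; the Set-Fmla one: $\Phi\vdash\psi$ iff $\Phi\rhd\{\psi\}$. $\Phi\rhd^{\le}_{\mathsf K}\Psi$ iff for some finite $\Phi'\subseteq\Phi,\Psi'\subseteq\Psi$, $\bigwedge\Phi'\le\bigvee\Psi'$ is valid in $\mathsf K$ ($\bigwedge\varnothing=\top$, $\bigvee\varnothing=\bot$); $\mathcal{PP}^{\rhd,\Rightarrow_H}_{\le}$ is this logic for $\mathsf K=\mathbb V(\mathbf{PP}_6^{\Rightarrow_H})$ and $\mathcal{PP}^{\Rightarrow_H}_{\le}$ its Set-Fmla companion ($\Phi\vdash\psi$ iff $\Phi\rhd\{\psi\}$). $\mathcal{PP}^{\rhd,\Rightarrow_H}_{\mathsf{up}}$ is the Set-Set logic determined by the class $\{\langle\mathbf{PP}_6^{\Rightarrow_H},{\uparrow}a\rangle: a\in\mathcal V_6\}$. -}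

module Defs where

open import Level using (Level; _⊔_) renaming (suc to lsuc; zero to lzero)
open import Data.Nat using (ℕ)
open import Data.Bool using (Bool; true; false; if_then_else_; _∧_)
open import Data.List using (List; []; _∷_; foldr)
open import Data.List.Relation.Unary.All using (All)
open import Data.Product using (Σ; _×_)
open import Relation.Binary.PropositionalEquality using (_≡_)
open import Relation.Nullary using (¬_)
open import Function.Bundles using (_⇔_)

infixr 6 _∧̇_
infixr 5 _∨̇_
infixr 4 _⇒̇_

data Fm : Set where
  var  : ℕ → Fm
  _∧̇_  : Fm → Fm → Fm
  _∨̇_  : Fm → Fm → Fm
  _⇒̇_  : Fm → Fm → Fm
  ∼̇    : Fm → Fm
  ∘̇    : Fm → Fm
  ⊥̇    : Fm
  ⊤̇    : Fm

FmSet : Set₁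
FmSet = Fm → Set

record Algebra (c : Level) : Set (lsuc c) where
  field
    Carrier : Set c
    meet join imp : Carrier → Carrier → Carrier
    neg circ : Carrier → Carrier
    bot top : Carrier

⟦_⟧ : ∀ {c} {A : Algebra c} → Fm → (ℕ → Algebra.Carrier A) → Algebra.Carrier A
⟦_⟧ {A = A} (var x) h = h x
⟦_⟧ {A = A} (φ ∧̇ ψ) h = Algebra.meet A (⟦_⟧ {A = A} φ h) (⟦_⟧ {A = A} ψ h)
⟦_⟧ {A = A} (φ ∨̇ ψ) h = Algebra.join A (⟦_⟧ {A = A} φ h) (⟦_⟧ {A = A} ψ h)
⟦_⟧ {A = A} (φ ⇒̇ ψ) h = Algebra.imp A (⟦_⟧ {A = A} φ h) (⟦_⟧ {A = A} ψ h)
⟦_⟧ {A = A} (∼̇ φ) h = Algebra.neg A (⟦_⟧ {A = A} φ h)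
⟦_⟧ {A = A} (∘̇ φ) h = Algebra.circ A (⟦_⟧ {A = A} φ h)
⟦_⟧ {A = A} ⊥̇ h = Algebra.bot A
⟦_⟧ {A = A} ⊤̇ h = Algebra.top A

record Matrix (c ℓ : Level) : Set (lsuc (c ⊔ ℓ)) where
  field
    alg : Algebra c
    D   : Algebra.Carrier alg → Set ℓ

-- Set-Set consequence of a matrix:  Φ ▷_M Ψ  iff for every valuation h,
-- h(φ) ∉ D for some φ ∈ Φ or h(ψ) ∈ D for some ψ ∈ Ψ
-- (stated in the classically equivalent implicational form).
_▷[_]_ : ∀ {c ℓ} → FmSet → Matrix c ℓ → FmSet → Set (c ⊔ ℓ)
Φ ▷[ M ] Ψ =
  ∀ (h : ℕ → Algebra.Carrier (Matrix.alg M)) →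
    (∀ φ → Φ φ → Matrix.D M (⟦_⟧ {A = Matrix.alg M} φ h)) →
    ¬ (∀ ψ → Ψ ψ → ¬ Matrix.D M (⟦_⟧ {A = Matrix.alg M} ψ h))

｛_｝ : Fm → FmSet
｛ ψ ｝ = λ χ → χ ≡ ψ

_⊢[_]_ : ∀ {c ℓ} → FmSet → Matrix c ℓ → Fm → Set (c ⊔ ℓ)
Φ ⊢[ M ] ψ = Φ ▷[ M ] ｛ ψ ｝

SSDeterminedBy : ∀ {c ℓ} → (FmSet → FmSet → Set) → Matrix c ℓ → Set (lsuc lzero ⊔ c ⊔ ℓ)
SSDeterminedBy L M = ∀ (Φ Ψ : FmSet) → L Φ Ψ ⇔ (Φ ▷[ M ] Ψ)

SFDeterminedBy : ∀ {c ℓ} → (FmSet → Fm → Set) → Matrix c ℓ → Set (lsuc lzero ⊔ c ⊔ ℓ)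
SFDeterminedBy L M = ∀ (Φ : FmSet) (ψ : Fm) → L Φ ψ ⇔ (Φ ⊢[ M ] ψ)

data V6 : Set where
  f̂ f n b t t̂ : V6

-- the order: f̂ < f < n < t < t̂,  f < b < t
_≤₆_ : V6 → V6 → Bool
f̂ ≤₆ _  = true
_ ≤₆ t̂  = true
f ≤₆ f̂  = false
f ≤₆ _  = true
n ≤₆ n  = true
n ≤₆ t  = true
b ≤₆ b  = true
b ≤₆ t  = true
t ≤₆ t  = true
_ ≤₆ _  = false

-- elements listed along a descending linear extension of ≤₆
desc : List V6
desc = t̂ ∷ t ∷ n ∷ b ∷ f ∷ f̂ ∷ []

asc : List V6
asc = f̂ ∷ f ∷ n ∷ b ∷ t ∷ t̂ ∷ []

first : (V6 → Bool) → V6 → List V6 → V6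
first p d [] = d
first p d (x ∷ xs) = if p x then x else first p d xs

_⊓₆_ : V6 → V6 → V6
x ⊓₆ y = first (λ c → (c ≤₆ x) ∧ (c ≤₆ y)) f̂ desc

_⊔₆_ : V6 → V6 → V6
x ⊔₆ y = first (λ c → (x ≤₆ c) ∧ (y ≤₆ c)) t̂ asc

_⇒₆_ : V6 → V6 → V6
x ⇒₆ y = first (λ c → (x ⊓₆ c) ≤₆ y) f̂ desc

∼₆ : V6 → V6
∼₆ f̂ = t̂
∼₆ f = t
∼₆ n = n
∼₆ b = b
∼₆ t = f
∼₆ t̂ = f̂

∘₆ : V6 → V6
∘₆ f̂ = t̂
∘₆ t̂ = t̂
∘₆ _ = f̂

PP6H : Algebra lzero
PP6H = record
  { Carrier = V6
  ; meet = _⊓₆_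
  ; join = _⊔₆_
  ; imp  = _⇒₆_
  ; neg  = ∼₆
  ; circ = ∘₆
  ; bot  = f̂
  ; top  = t̂
  }

⟦_⟧₆ : Fm → (ℕ → V6) → V6
⟦ φ ⟧₆ v = ⟦_⟧ {A = PP6H} φ v

⋀ : List Fm → Fm
⋀ = foldr _∧̇_ ⊤̇

⋁ : List Fm → Fm
⋁ = foldr _∨̇_ ⊥̇

-- the inequation  φ ≤ ψ  is valid in V(PP6^{⇒H})
-- (equivalently, valid in the generating algebra PP6^{⇒H})
ValidLeq : Fm → Fm → Set
ValidLeq φ ψ = ∀ (v : ℕ → V6) → (⟦ φ ⟧₆ v ≤₆ ⟦ ψ ⟧₆ v) ≡ true

PPle▷ : FmSet → FmSet → Set
PPle▷ Φ Ψ = Σ (List Fm) λ Φ' → Σ (List Fm) λ Ψ' →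
  All Φ Φ' × All Ψ Ψ' × ValidLeq (⋀ Φ') (⋁ Ψ')

PPle⊢ : FmSet → Fm → Set
PPle⊢ Φ ψ = PPle▷ Φ ｛ ψ ｝

upMatrix : V6 → Matrix lzero lzero
upMatrix a = record { alg = PP6H ; D = λ x → (a ≤₆ x) ≡ true }

PPup▷ : FmSet → FmSet → Set
PPup▷ Φ Ψ = ∀ (a : V6) → Φ ▷[ upMatrix a ] Ψ

-- A logic determined by a single matrix is cancellative: if φ and ψ share no variables, {φ} ▷ ψ
-- holds and some valuation refutes ψ, then splicing that valuation with any valuation designating
-- φ would designate φ and refute ψ, so no valuation designates φ and φ entails everything.
-- In PP6^{⇒H}, q ∧ ∼q ≤ t ≤ p ∨ (p ⇒ ∼p), so q ∧ ∼q entails p ∨ (p ⇒ ∼p) in all three logics;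
-- yet p ∨ (p ⇒ ∼p) takes the value t (not t̂) under p ↦ t, and q ∧ ∼q does not entail ⊥, as its
-- value under q ↦ n or q ↦ t lies above f̂.
module Submission where

open import Defs
open import Data.Bool using (Bool; true; false; not; if_then_else_; T)
open import Data.Empty using (⊥)
open import Data.List using ([]; _∷_)
open import Data.List.Relation.Unary.All using (All; []; _∷_)
open import Data.Nat using (ℕ; _≡ᵇ_)
open import Data.Product using (_×_; _,_)
open import Data.Sum using (_⊎_; inj₁; inj₂)
open import Data.Unit using (tt) renaming (⊤ to Unit)
open import Function using (_∘_; const)
open import Function.Bundles using (Equivalence)
open import Relation.Binary.PropositionalEquality using (_≡_; refl; sym; subst)
open import Relation.Nullary using (¬_)

open Equivalence using (to; from)

∅ : FmSet
∅ = λ _ → ⊥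

Vars⊆ : (ℕ → Set) → Fm → Set
Vars⊆ P (var x)  = P x
Vars⊆ P (φ ∧̇ ψ)  = Vars⊆ P φ × Vars⊆ P ψ
Vars⊆ P (φ ∨̇ ψ)  = Vars⊆ P φ × Vars⊆ P ψ
Vars⊆ P (φ ⇒̇ ψ)  = Vars⊆ P φ × Vars⊆ P ψ
Vars⊆ P (∼̇ φ)    = Vars⊆ P φ
Vars⊆ P (∘̇ φ)    = Vars⊆ P φ
Vars⊆ P ⊥̇        = Unit
Vars⊆ P ⊤̇        = Unit

⟦⟧-cong : ∀ {c} (A : Algebra c) {P : ℕ → Set} (φ : Fm) {h h' : ℕ → Algebra.Carrier A} →
  (∀ x → P x → h x ≡ h' x) → Vars⊆ P φ → ⟦_⟧ {A = A} φ h ≡ ⟦_⟧ {A = A} φ h'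
⟦⟧-cong A (var x)  eq px = eq x px
⟦⟧-cong A (φ ∧̇ ψ) eq (pφ , pψ) rewrite ⟦⟧-cong A φ eq pφ | ⟦⟧-cong A ψ eq pψ = refl
⟦⟧-cong A (φ ∨̇ ψ) eq (pφ , pψ) rewrite ⟦⟧-cong A φ eq pφ | ⟦⟧-cong A ψ eq pψ = refl
⟦⟧-cong A (φ ⇒̇ ψ) eq (pφ , pψ) rewrite ⟦⟧-cong A φ eq pφ | ⟦⟧-cong A ψ eq pψ = refl
⟦⟧-cong A (∼̇ φ)   eq pφ rewrite ⟦⟧-cong A φ eq pφ = refl
⟦⟧-cong A (∘̇ φ)   eq pφ rewrite ⟦⟧-cong A φ eq pφ = refl
⟦⟧-cong A ⊥̇       eq _ = refl
⟦⟧-cong A ⊤̇       eq _ = refl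

splice : ∀ {c} {X : Set c} → (ℕ → Bool) → (ℕ → X) → (ℕ → X) → ℕ → X
splice s h h' x = if s x then h x else h' x

splice-agreesˡ : ∀ {c} {X : Set c} (s : ℕ → Bool) (h h' : ℕ → X) →
  ∀ x → T (s x) → splice s h h' x ≡ h x
splice-agreesˡ s h h' x sx with s x
... | true = refl

splice-agreesʳ : ∀ {c} {X : Set c} (s : ℕ → Bool) (h h' : ℕ → X) →
  ∀ x → T (not (s x)) → splice s h h' x ≡ h' x
splice-agreesʳ s h h' x sx with s x
... | false = refl

module _ {c ℓ} (M : Matrix c ℓ) where
  open Matrix M

  ▷-cancel : (s : ℕ → Bool) {φ ψ : Fm} → Vars⊆ (T ∘ s) φ → Vars⊆ (T ∘ not ∘ s) ψ →
    ｛ φ ｝ ▷[ M ] ｛ ψ ｝ → ¬ (∅ ▷[ M ] ｛ ψ ｝) → ∀ Ψ → ｛ φ ｝ ▷[ M ] Ψ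
  ▷-cancel s {φ} {ψ} varsφ varsψ φ▷ψ ψ-refutable Ψ h φ∈D _ =
    ψ-refutable λ h' _ ψ∉D →
      let h″ = splice s h h'
          φ-unchanged = ⟦⟧-cong alg φ (splice-agreesˡ s h h') varsφ
          ψ-unchanged = ⟦⟧-cong alg ψ (splice-agreesʳ s h h') varsψ
      in φ▷ψ h″ (λ { _ refl → subst D (sym φ-unchanged) (φ∈D φ refl) })
                (λ { _ refl ψ∈D → ψ∉D ψ refl (subst D ψ-unchanged ψ∈D) })

  ¬SFDeterminedBy : (s : ℕ → Bool) {φ ψ χ : Fm} → Vars⊆ (T ∘ s) φ → Vars⊆ (T ∘ not ∘ s) ψ →
    {L : FmSet → Fm → Set} → L ｛ φ ｝ ψ → ¬ L ∅ ψ → ¬ L ｛ φ ｝ χ → ¬ SFDeterminedBy L M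
  ¬SFDeterminedBy s {φ} {ψ} {χ} varsφ varsψ φ⊢ψ ⊬ψ φ⊬χ determined =
    φ⊬χ (from (determined ｛ φ ｝ χ)
      (▷-cancel s varsφ varsψ (to (determined ｛ φ ｝ ψ) φ⊢ψ) (⊬ψ ∘ from (determined ∅ ψ)) ｛ χ ｝))

⊓₆-identityʳ : ∀ x → x ⊓₆ t̂ ≡ x
⊓₆-identityʳ f̂ = refl
⊓₆-identityʳ f = refl
⊓₆-identityʳ n = refl
⊓₆-identityʳ b = refl
⊓₆-identityʳ t = refl
⊓₆-identityʳ t̂ = refl

⊓₆-idem : ∀ x → x ⊓₆ x ≡ x
⊓₆-idem f̂ = refl
⊓₆-idem f = refl
⊓₆-idem n = refl
⊓₆-idem b = refl
⊓₆-idem t = refl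
⊓₆-idem t̂ = refl

⊔₆-identityʳ : ∀ x → x ⊔₆ f̂ ≡ x
⊔₆-identityʳ f̂ = refl
⊔₆-identityʳ f = refl
⊔₆-identityʳ n = refl
⊔₆-identityʳ b = refl
⊔₆-identityʳ t = refl
⊔₆-identityʳ t̂ = refl

⊔₆-idem : ∀ x → x ⊔₆ x ≡ x
⊔₆-idem f̂ = refl
⊔₆-idem f = refl
⊔₆-idem n = refl
⊔₆-idem b = refl
⊔₆-idem t = refl
⊔₆-idem t̂ = refl

≤₆-trans-below-t : ∀ {a x} → (a ≤₆ x) ≡ true → (x ≤₆ t) ≡ true → (a ≤₆ t) ≡ true
≤₆-trans-below-t {f̂} _ _ = refl
≤₆-trans-below-t {f} _ _ = refl
≤₆-trans-below-t {n} _ _ = refl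
≤₆-trans-below-t {b} _ _ = refl
≤₆-trans-below-t {t} _ _ = refl
≤₆-trans-below-t {t̂} {t̂} _ ()

≤₆-trans-above-t : ∀ {a z} → (a ≤₆ t) ≡ true → (t ≤₆ z) ≡ true → (a ≤₆ z) ≡ true
≤₆-trans-above-t {z = t} a≤t _ = a≤t
≤₆-trans-above-t {f̂} {t̂} _ _ = refl
≤₆-trans-above-t {f} {t̂} _ _ = refl
≤₆-trans-above-t {n} {t̂} _ _ = refl
≤₆-trans-above-t {b} {t̂} _ _ = refl
≤₆-trans-above-t {t} {t̂} _ _ = refl

x⊓∼x≤t : ∀ x → ((x ⊓₆ ∼₆ x) ≤₆ t) ≡ true
x⊓∼x≤t f̂ = refl
x⊓∼x≤t f = refl
x⊓∼x≤t n = refl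
x⊓∼x≤t b = refl
x⊓∼x≤t t = refl
x⊓∼x≤t t̂ = refl

t≤x⊔[x⇒∼x] : ∀ x → (t ≤₆ (x ⊔₆ (x ⇒₆ ∼₆ x))) ≡ true
t≤x⊔[x⇒∼x] f̂ = refl
t≤x⊔[x⇒∼x] f = refl
t≤x⊔[x⇒∼x] n = refl
t≤x⊔[x⇒∼x] b = refl
t≤x⊔[x⇒∼x] t = refl
t≤x⊔[x⇒∼x] t̂ = refl

⋀-copies : ∀ {φ} Φ' → All ｛ φ ｝ Φ' → ∀ v → ⟦ ⋀ Φ' ⟧₆ v ≡ t̂ ⊎ ⟦ ⋀ Φ' ⟧₆ v ≡ ⟦ φ ⟧₆ v
⋀-copies [] [] v = inj₁ refl
⋀-copies (φ ∷ Φ') (refl ∷ copies) v with ⟦ ⋀ Φ' ⟧₆ v | ⋀-copies Φ' copies v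
... | _ | inj₁ refl = inj₂ (⊓₆-identityʳ (⟦ φ ⟧₆ v))
... | _ | inj₂ refl = inj₂ (⊓₆-idem (⟦ φ ⟧₆ v))

⋁-copies : ∀ {ψ} Ψ' → All ｛ ψ ｝ Ψ' → ∀ v → ⟦ ⋁ Ψ' ⟧₆ v ≡ f̂ ⊎ ⟦ ⋁ Ψ' ⟧₆ v ≡ ⟦ ψ ⟧₆ v
⋁-copies [] [] v = inj₁ refl
⋁-copies (ψ ∷ Ψ') (refl ∷ copies) v with ⟦ ⋁ Ψ' ⟧₆ v | ⋁-copies Ψ' copies v
... | _ | inj₁ refl = inj₂ (⊔₆-identityʳ (⟦ ψ ⟧₆ v))
... | _ | inj₂ refl = inj₂ (⊔₆-idem (⟦ ψ ⟧₆ v))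

p∨[p⇒∼p] q∧∼q : Fm
p∨[p⇒∼p] = var 0 ∨̇ (var 0 ⇒̇ ∼̇ (var 0))
q∧∼q = var 1 ∧̇ ∼̇ (var 1)

PPle-q∧∼q▷p∨[p⇒∼p] : PPle▷ ｛ q∧∼q ｝ ｛ p∨[p⇒∼p] ｝
PPle-q∧∼q▷p∨[p⇒∼p] = q∧∼q ∷ [] , p∨[p⇒∼p] ∷ [] , refl ∷ [] , refl ∷ [] , valid
  where
  valid : ValidLeq (q∧∼q ∧̇ ⊤̇) (p∨[p⇒∼p] ∨̇ ⊥̇)
  valid v rewrite ⊓₆-identityʳ (⟦ q∧∼q ⟧₆ v) | ⊔₆-identityʳ (⟦ p∨[p⇒∼p] ⟧₆ v) =
    ≤₆-trans-above-t (x⊓∼x≤t (v 1)) (t≤x⊔[x⇒∼x] (v 0))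

PPle-⋫p∨[p⇒∼p] : ¬ PPle▷ ∅ ｛ p∨[p⇒∼p] ｝
PPle-⋫p∨[p⇒∼p] ((_ ∷ _) , _ , () ∷ _ , _)
PPle-⋫p∨[p⇒∼p] ([] , Ψ' , [] , copies , valid)
  with ⟦ ⋁ Ψ' ⟧₆ (const t) | ⋁-copies Ψ' copies (const t) | valid (const t)
... | _ | inj₁ refl | ()
... | _ | inj₂ refl | ()

PPle-q∧∼q⋫⊥ : ¬ PPle▷ ｛ q∧∼q ｝ ｛ ⊥̇ ｝
PPle-q∧∼q⋫⊥ (Φ' , Ψ' , copiesΦ , copiesΨ , valid)
  with ⟦ ⋀ Φ' ⟧₆ (const n) | ⋀-copies Φ' copiesΦ (const n)
     | ⟦ ⋁ Ψ' ⟧₆ (const n) | ⋁-copies Ψ' copiesΨ (const n) | valid (const n)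
... | _ | inj₁ refl | _ | inj₁ refl | ()
... | _ | inj₁ refl | _ | inj₂ refl | ()
... | _ | inj₂ refl | _ | inj₁ refl | ()
... | _ | inj₂ refl | _ | inj₂ refl | ()

PPup-q∧∼q▷p∨[p⇒∼p] : PPup▷ ｛ q∧∼q ｝ ｛ p∨[p⇒∼p] ｝
PPup-q∧∼q▷p∨[p⇒∼p] a h q∧∼q∈↑a p∨[p⇒∼p]∉↑a =
  p∨[p⇒∼p]∉↑a _ refl
    (≤₆-trans-above-t (≤₆-trans-below-t (q∧∼q∈↑a _ refl) (x⊓∼x≤t (h 1))) (t≤x⊔[x⇒∼x] (h 0)))

PPup-⋫p∨[p⇒∼p] : ¬ PPup▷ ∅ ｛ p∨[p⇒∼p] ｝
PPup-⋫p∨[p⇒∼p] valid = valid t̂ (const t) (λ _ ()) (λ { _ refl () })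

PPup-q∧∼q⋫⊥ : ¬ PPup▷ ｛ q∧∼q ｝ ｛ ⊥̇ ｝
PPup-q∧∼q⋫⊥ valid = valid f (const t) (λ { _ refl → refl }) (λ { _ refl () })

theorem5p7 : ∀ {c ℓ} →
    (∀ (M : Matrix c ℓ) → ¬ SFDeterminedBy PPle⊢ M) ×
    (∀ (M : Matrix c ℓ) → ¬ SSDeterminedBy PPle▷ M) ×
    (∀ (M : Matrix c ℓ) → ¬ SSDeterminedBy PPup▷ M)
theorem5p7 =
  (λ M → refuted M PPle-q∧∼q▷p∨[p⇒∼p] PPle-⋫p∨[p⇒∼p] PPle-q∧∼q⋫⊥) ,
  (λ M → refuted M PPle-q∧∼q▷p∨[p⇒∼p] PPle-⋫p∨[p⇒∼p] PPle-q∧∼q⋫⊥ ∘ companion PPle▷ {M}) ,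
  (λ M → refuted M PPup-q∧∼q▷p∨[p⇒∼p] PPup-⋫p∨[p⇒∼p] PPup-q∧∼q⋫⊥ ∘ companion PPup▷ {M})
  where
  companion : ∀ {c ℓ} (L : FmSet → FmSet → Set) {M : Matrix c ℓ} →
    SSDeterminedBy L M → SFDeterminedBy (λ Φ ψ → L Φ ｛ ψ ｝) M
  companion L determined Φ ψ = determined Φ ｛ ψ ｝

  refuted : ∀ {c ℓ} (M : Matrix c ℓ) {L : FmSet → Fm → Set} →
    L ｛ q∧∼q ｝ p∨[p⇒∼p] → ¬ L ∅ p∨[p⇒∼p] → ¬ L ｛ q∧∼q ｝ ⊥̇ → ¬ SFDeterminedBy L M
  refuted M = ¬SFDeterminedBy M (_≡ᵇ 1) (tt , tt) (tt , tt , tt)
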